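{- Let $R$ be a set of requests in a bidirected tree $T$. There exist a bidirected tree $\tilde T$ and a set $\tilde R$ of requests in $\tilde T$, each of length at least $2$ (i.e. $(\tilde R,\tilde T)$ is a nice pair), such that $\mathcal{I}(R,T)=\mathcal{I}(\tilde R,\tilde T)$ (up to the natural identification of $R$ with $\tilde R$).
   Context: A bidirected tree $T$ is a digraph obtained from a finite undirected tree by replacing each edge $uv$ by the two arcs $(u,v)$ and $(v,u)$. A request in $T$ is a directed path in $T$ with at least one arc; its length is its number of arcs. For a directed path $r$, $s_r$ is its first vertex, $t_r$ its last vertex, $s_r^+$ its second vertex, $t_r^-$ its penultimate vertex; its emission arc is $(s_r,s_r^+)$ and its reception arc is $(t_r^-,t_r)$. $T[x,y]$ denotes the unique directed path from $x$ to $y$ in $T$. A request $r$ interferes on $r'$ if $T[s_r,t_{r'}]$ has first arc the emission arc of $r$ and last arc the reception arc of $r'$; two requests interfere if one interferes on the other. $\mathcal{I}(R,T)$ is the graph on $R$ with an edge between two distinct requests iff they interfere. A nice pair $(R,T)$ is a set $R$ of requests in a bidirected tree $T$ in which every request has length at least $2$. -}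

module Defs where

open import Data.Nat using (ℕ; _≤_)
open import Data.Fin using (Fin)
open import Data.Bool using (Bool; true; false)
open import Data.List using (List; []; _∷_; _++_; [_]; length)
open import Data.List.Relation.Unary.Linked using (Linked)
open import Data.List.Relation.Unary.Unique.Propositional using (Unique)
open import Data.Product using (Σ; ∃; _×_)
open import Data.Sum using (_⊎_)
open import Relation.Binary.PropositionalEquality using (_≡_)

FirstArc : {V : Set} → List V → V → V → Set
FirstArc {V} p u v = Σ (List V) λ rest → p ≡ u ∷ v ∷ rest

LastArc : {V : Set} → List V → V → V → Set
LastArc {V} p u v = Σ (List V) λ init → p ≡ init ++ (u ∷ v ∷ [])

StartsAt : {V : Set} → List V → V → Set
StartsAt {V} p x = Σ (List V) λ rest → p ≡ x ∷ rest

EndsAt : {V : Set} → List V → V → Set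
EndsAt {V} p y = Σ (List V) λ init → p ≡ init ++ [ y ]

IsPath : {n : ℕ} → (Fin n → Fin n → Bool) → List (Fin n) → Set
IsPath adj p = Linked (λ u v → adj u v ≡ true) p × Unique p

record Tree (n : ℕ) : Set where
  field
    adj       : Fin n → Fin n → Bool
    irrefl    : ∀ x → adj x x ≡ false
    symmetric : ∀ x y → adj x y ≡ adj y x
    nonempty  : 1 ≤ n
    uniquePath : ∀ x y → Σ (List (Fin n)) λ P →
                   (IsPath adj P × StartsAt P x × EndsAt P y) ×
                   (∀ Q → IsPath adj Q → StartsAt Q x → EndsAt Q y → Q ≡ P)

open Tree public

Request : {n : ℕ} → Tree n → List (Fin n) → Set
Request T r = IsPath (adj T) r × 2 ≤ length r

-- r interferes on r': the path T[s_r , t_r'] has first arc the emission arc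
-- of r and last arc the reception arc of r'.  (Since paths in a tree are
-- unique, "the" path is any directed path from s_r to t_r'.)
InterferesOn : {n : ℕ} → Tree n → List (Fin n) → List (Fin n) → Set
InterferesOn {n} T r r' =
  Σ (List (Fin n)) λ P → IsPath (adj T) P ×
  (Σ (Fin n) λ a → Σ (Fin n) λ b → FirstArc r a b × FirstArc P a b) ×
  (Σ (Fin n) λ c → Σ (Fin n) λ d → LastArc r' c d × LastArc P c d)

Interfere : {n : ℕ} → Tree n → List (Fin n) → List (Fin n) → Set
Interfere T r r' = InterferesOn T r r' ⊎ InterferesOn T r' r

-- Subdivide every edge of T. A request x₀ x₁ … x_k becomes x₀ m₀₁ x₁ … x_k, of length 2k ≥ 2. Every
-- path of the subdivision between original vertices is the subdivision of a path of T, and its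
-- emission arc (x₀ , m₀₁) and reception arc (m_{k-1,k} , x_k) determine the arcs (x₀ , x₁) and
-- (x_{k-1} , x_k); so r interferes on r′ in T exactly when their subdivisions do. The subdivision is
-- again a tree: it is connected, and a cycle through a midpoint would pass through both of its
-- neighbours, giving a cycle of T.
module Submission where

open import Defs
open import Data.Nat using (ℕ; _≤_; s≤s; z≤n; _+_; _*_)
open import Data.Nat.Properties using (≤-trans; m≤m+n)
open import Data.Fin using (Fin; _<_; _<?_)
open import Data.Fin.Properties using (_≟_; <-cmp; <-asym; +↔⊎; *↔×)
open import Data.List using (List; []; _∷_; _++_; [_]; length; map; mapMaybe)
open import Data.List.Properties using (∷-injectiveʳ; ++-assoc; map-++; map-∘; map-cong; map-id; map-injective)
open import Data.List.Relation.Unary.Linked as Linked using (Linked; []; [-]; _∷_)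
import Data.List.Relation.Unary.Linked.Properties as Linked
open import Data.List.Relation.Unary.Any using (here; there)
open import Data.List.Relation.Unary.All using ([]; _∷_)
open import Data.List.Relation.Unary.All.Properties using (¬Any⇒All¬; All¬⇒¬Any)
open import Data.List.Relation.Unary.AllPairs using ([]; _∷_)
open import Data.List.Relation.Unary.Unique.Propositional using (Unique)
import Data.List.Relation.Unary.Unique.Propositional.Properties as Unique
open import Data.List.Membership.Propositional using (_∈_; _∉_)
open import Data.List.Membership.Propositional.Properties using (∈-++⁺ˡ)
open import Data.List.Relation.Binary.Subset.Propositional using (_⊆_)
open import Data.Product using (Σ; _×_; _,_; proj₁; proj₂)
import Data.Product.Properties as Product
open import Data.Sum using (_⊎_; inj₁; inj₂; isInj₁)
import Data.Sum.Properties as Sum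
open import Data.Sum.Function.Propositional using (_⊎-⇔_; _⊎-↔_)
open import Data.Empty using (⊥; ⊥-elim)
open import Data.Bool using (Bool; true; false)
open import Function using (_on_; _∘_)
open import Function.Bundles using (_↔_; Inverse; Injection; _⇔_; mk⇔)
open import Function.Definitions using (Injective)
open import Function.Properties.Inverse using (↔-refl; ↔-sym; ↔-trans; Inverse⇒Injection)
import Function.Properties.Equivalence as ⇔
open import Relation.Nullary using (yes; no)
open import Relation.Binary.Definitions using (DecidableEquality; Symmetric; tri<; tri≈; tri>)
open import Relation.Binary.Construct.Closure.ReflexiveTransitive using (Star; ε; _◅_; _◅◅_; revApp; reverse)
open import Relation.Binary.PropositionalEquality using (_≡_; _≢_; refl; sym; trans; cong; subst; subst₂)

Edge : {V : Set} → (V → V → Bool) → V → V → Set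
Edge adjacent u v = adjacent u v ≡ true

module _ {V : Set} where

  head-∉ : ∀ {x : V} {xs} → Unique (x ∷ xs) → x ∉ xs
  head-∉ (x∉xs ∷ _) = All¬⇒¬Any x∉xs

  ∉-Unique-∷ : ∀ {x : V} {xs} → x ∉ xs → Unique xs → Unique (x ∷ xs)
  ∉-Unique-∷ {xs = xs} x∉xs u = ¬Any⇒All¬ xs x∉xs ∷ u

  Unique-tail : ∀ {x : V} {xs} → Unique (x ∷ xs) → Unique xs
  Unique-tail (_ ∷ u) = u

  EndsAt-tail : ∀ {x y z : V} {xs} → EndsAt (x ∷ y ∷ xs) z → EndsAt (y ∷ xs) z
  EndsAt-tail ([] , ())
  EndsAt-tail (_ ∷ init , eq) = init , ∷-injectiveʳ eq

  FirstArc⇒StartsAt : ∀ {P} {a b : V} → FirstArc P a b → StartsAt P a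
  FirstArc⇒StartsAt {b = b} (rest , refl) = b ∷ rest , refl

  LastArc⇒EndsAt : ∀ {P} {c d : V} → LastArc P c d → EndsAt P d
  LastArc⇒EndsAt {c = c} {d} (init , refl) = init ++ [ c ] , sym (++-assoc init [ c ] [ d ])

module _ {V : Set} (E : V → V → Set) where

  -- For E = Edge (adj T), IsPathᴱ and InterferesOnᴱ below are IsPath (adj T) and InterferesOn T, definitionally.
  IsPathᴱ : List V → Set
  IsPathᴱ P = Linked E P × Unique P

  UniquelyConnected : Set
  UniquelyConnected = ∀ x y → Σ (List V) λ P →
    (IsPathᴱ P × StartsAt P x × EndsAt P y) ×
    (∀ Q → IsPathᴱ Q → StartsAt Q x → EndsAt Q y → Q ≡ P)

  Acyclic : Set
  Acyclic = ∀ {x y} P → E x y → IsPathᴱ P → StartsAt P x → EndsAt P y → P ≡ x ∷ y ∷ []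

  InterferesOnᴱ : List V → List V → Set
  InterferesOnᴱ r q = Σ (List V) λ P → IsPathᴱ P ×
    (Σ V λ a → Σ V λ b → FirstArc r a b × FirstArc P a b) ×
    (Σ V λ c → Σ V λ d → LastArc q c d × LastArc P c d)

module Walks {V : Set} {E : V → V → Set} where

  vertices : ∀ {x y} → Star E x y → List V
  vertices {x} ε = x ∷ []
  vertices {x} (_ ◅ w) = x ∷ vertices w

  vertices-Linked : ∀ {x y} (w : Star E x y) → Linked E (vertices w)
  vertices-Linked ε = [-]
  vertices-Linked (e ◅ ε) = e ∷ [-]
  vertices-Linked (e ◅ w@(_ ◅ _)) = e ∷ vertices-Linked w

  vertices-StartsAt : ∀ {x y} (w : Star E x y) → StartsAt (vertices w) x
  vertices-StartsAt ε = [] , refl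
  vertices-StartsAt (_ ◅ w) = vertices w , refl

  vertices-EndsAt : ∀ {x y} (w : Star E x y) → EndsAt (vertices w) y
  vertices-EndsAt ε = [] , refl
  vertices-EndsAt {x} (_ ◅ w) with vertices-EndsAt w
  ... | init , eq = x ∷ init , cong (x ∷_) eq

  start∈vertices : ∀ {x y} (w : Star E x y) → x ∈ vertices w
  start∈vertices ε = here refl
  start∈vertices (_ ◅ _) = here refl

  end∈vertices : ∀ {x y} (w : Star E x y) → y ∈ vertices w
  end∈vertices ε = here refl
  end∈vertices (_ ◅ w) = there (end∈vertices w)

  walk-along : ∀ {x y} P → Linked E P → StartsAt P x → EndsAt P y →
               Σ (Star E x y) λ w → vertices w ≡ P
  walk-along [] _ (_ , ())
  walk-along (x ∷ []) _ (_ , refl) ([] , refl) = ε , refl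
  walk-along (x ∷ []) _ (_ , refl) (_ ∷ [] , ())
  walk-along (x ∷ []) _ (_ , refl) (_ ∷ _ ∷ _ , ())
  walk-along (x ∷ y ∷ P) (e ∷ linked) (_ , refl) ends
    with walk-along (y ∷ P) linked (P , refl) (EndsAt-tail ends)
  ... | w , eq = e ◅ w , cong (x ∷_) eq

  ∈-◅◅⁻ : ∀ {x y z v} (w₁ : Star E x y) (w₂ : Star E y z) →
          v ∈ vertices (w₁ ◅◅ w₂) → v ∈ vertices w₁ ⊎ v ∈ vertices w₂
  ∈-◅◅⁻ ε w₂ v∈ = inj₂ v∈
  ∈-◅◅⁻ (_ ◅ w₁) w₂ (here eq) = inj₁ (here eq)
  ∈-◅◅⁻ (_ ◅ w₁) w₂ (there v∈) with ∈-◅◅⁻ w₁ w₂ v∈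
  ... | inj₁ v∈w₁ = inj₁ (there v∈w₁)
  ... | inj₂ v∈w₂ = inj₂ v∈w₂

  ∈-revApp⁻ : ∀ {x y z v} (E-sym : Symmetric E) (w : Star E y x) (acc : Star E y z) →
              v ∈ vertices (revApp E-sym w acc) → v ∈ vertices w ⊎ v ∈ vertices acc
  ∈-revApp⁻ E-sym ε acc v∈ = inj₂ v∈
  ∈-revApp⁻ E-sym (e ◅ w) acc v∈ with ∈-revApp⁻ E-sym w (E-sym e ◅ acc) v∈
  ... | inj₁ v∈w = inj₁ (there v∈w)
  ... | inj₂ (here refl) = inj₁ (there (start∈vertices w))
  ... | inj₂ (there v∈acc) = inj₂ v∈acc

  ∈-reverse⁻ : ∀ {x y v} (E-sym : Symmetric E) (w : Star E x y) →
               v ∈ vertices (reverse E-sym w) → v ∈ vertices w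
  ∈-reverse⁻ E-sym w v∈ with ∈-revApp⁻ E-sym w ε v∈
  ... | inj₁ v∈w = v∈w
  ... | inj₂ (here refl) = start∈vertices w

  loop-unique : ∀ {x} (w : Star E x x) → Unique (vertices w) → vertices w ≡ x ∷ []
  loop-unique ε _ = refl
  loop-unique (_ ◅ w) u = ⊥-elim (head-∉ u (end∈vertices w))

  module _ (_≟_ : DecidableEquality V) where
    open import Data.List.Membership.DecPropositional _≟_ using (_∈?_)

    suffix-from : ∀ {x y v} (w : Star E x y) → v ∈ vertices w →
                  Σ (Star E v y) λ s → (Unique (vertices w) → Unique (vertices s)) × vertices s ⊆ vertices w
    suffix-from ε (here refl) = ε , (λ u → u) , (λ v∈ → v∈)
    suffix-from w@(_ ◅ _) (here refl) = w , (λ u → u) , (λ v∈ → v∈)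
    suffix-from (_ ◅ w) (there v∈) with suffix-from w v∈
    ... | s , unique , s⊆w = s , unique ∘ Unique-tail , there ∘ s⊆w

    shorten : ∀ {x y} (w : Star E x y) → Σ (Star E x y) λ s → Unique (vertices s) × vertices s ⊆ vertices w
    shorten ε = ε , ([] ∷ []) , (λ v∈ → v∈)
    shorten {x} (e ◅ w) with shorten w
    ... | s , unique , s⊆w with x ∈? vertices s
    ...   | yes x∈s with suffix-from s x∈s
    ...     | s′ , unique′ , s′⊆s = s′ , unique′ unique , there ∘ s⊆w ∘ s′⊆s
    shorten {x} (e ◅ w) | s , unique , s⊆w | no x∉s =
      e ◅ s , ∉-Unique-∷ x∉s unique , λ { (here eq) → here eq ; (there v∈) → there (s⊆w v∈) }

    module _ (E-sym : Symmetric E) (acyclic : Acyclic E) where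

      -- If w₁, w₂ leave x through distinct neighbours a, b, then the edge x a followed by w₁ and the reverse
      -- of w₂, shortened to a path (which avoids x), is a path from x to b other than the edge x b.
      walks-unique : ∀ {x y} (w₁ w₂ : Star E x y) → Unique (vertices w₁) → Unique (vertices w₂) →
                     vertices w₁ ≡ vertices w₂
      walks-unique ε ε _ _ = refl
      walks-unique ε (_ ◅ w₂) _ u₂ = ⊥-elim (head-∉ u₂ (end∈vertices w₂))
      walks-unique (_ ◅ w₁) ε u₁ _ = ⊥-elim (head-∉ u₁ (end∈vertices w₁))
      walks-unique {x} (_◅_ {j = a} e₁ w₁) (_◅_ {j = b} e₂ w₂) u₁ u₂ with a ≟ b
      ... | yes refl = cong (x ∷_) (walks-unique w₁ w₂ (Unique-tail u₁) (Unique-tail u₂))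
      ... | no a≢b with shorten (w₁ ◅◅ reverse E-sym w₂)
      ...   | s , unique , s⊆ = ⊥-elim (a≢b a≡b)
        where
          x∉s : x ∉ vertices s
          x∉s x∈s with ∈-◅◅⁻ w₁ (reverse E-sym w₂) (s⊆ x∈s)
          ... | inj₁ x∈w₁ = head-∉ u₁ x∈w₁
          ... | inj₂ x∈w₂ = head-∉ u₂ (∈-reverse⁻ E-sym w₂ x∈w₂)
          cycle : vertices (e₁ ◅ s) ≡ x ∷ b ∷ []
          cycle = acyclic (vertices (e₁ ◅ s)) e₂ (vertices-Linked (e₁ ◅ s) , ∉-Unique-∷ x∉s unique)
                    (vertices-StartsAt (e₁ ◅ s)) (vertices-EndsAt (e₁ ◅ s))
          a≡b : a ≡ b
          a≡b with subst (a ∈_) (∷-injectiveʳ cycle) (start∈vertices s)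
          ... | here a≡b = a≡b

      uniquely-connected : (∀ x y → Star E x y) → UniquelyConnected E
      uniquely-connected walk x y with shorten (walk x y)
      ... | s , unique , _ =
        vertices s , ((vertices-Linked s , unique) , vertices-StartsAt s , vertices-EndsAt s) ,
        λ Q path start end → let w , eq = walk-along Q (proj₁ path) start end in
          trans (sym eq) (walks-unique w s (subst Unique (sym eq) (proj₂ path)) unique)

module Mapping {A B : Set} {E : A → A → Set} {E′ : B → B → Set} (f : A → B)
         (f-injective : ∀ {x y} → f x ≡ f y → x ≡ y) (f-edge : ∀ {x y} → E x y → E′ (f x) (f y)) where

  map-IsPath : ∀ {P} → IsPathᴱ E P → IsPathᴱ E′ (map f P)
  map-IsPath (linked , unique) = Linked.map⁺ (Linked.map f-edge linked) , Unique.map⁺ f-injective unique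

  map-StartsAt : ∀ {P x} → StartsAt P x → StartsAt (map f P) (f x)
  map-StartsAt (rest , refl) = map f rest , refl

  map-EndsAt : ∀ {P x} → EndsAt P x → EndsAt (map f P) (f x)
  map-EndsAt (init , refl) = map f init , map-++ f init _

  map-FirstArc : ∀ {P x y} → FirstArc P x y → FirstArc (map f P) (f x) (f y)
  map-FirstArc (rest , refl) = map f rest , refl

  map-LastArc : ∀ {P x y} → LastArc P x y → LastArc (map f P) (f x) (f y)
  map-LastArc (init , refl) = map f init , map-++ f init _

  map-InterferesOn : ∀ {r q} → InterferesOnᴱ E r q → InterferesOnᴱ E′ (map f r) (map f q)
  map-InterferesOn (P , path , (a , b , r-first , P-first) , (c , d , q-last , P-last)) =
    map f P , map-IsPath path ,
    (f a , f b , map-FirstArc r-first , map-FirstArc P-first) ,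
    (f c , f d , map-LastArc q-last , map-LastArc P-last)

module _ {A B : Set} (e : A ↔ B) where
  open Inverse e

  to-injective : Injective _≡_ _≡_ to
  to-injective = Injection.injective (Inverse⇒Injection e)

  from-injective : Injective _≡_ _≡_ from
  from-injective = Injection.injective (Inverse⇒Injection (↔-sym e))

  map-from-to : ∀ xs → map from (map to xs) ≡ xs
  map-from-to xs = trans (sym (map-∘ xs)) (trans (map-cong strictlyInverseʳ xs) (map-id xs))

  map-to-from : ∀ xs → map to (map from xs) ≡ xs
  map-to-from xs = trans (sym (map-∘ xs)) (trans (map-cong strictlyInverseˡ xs) (map-id xs))

  module _ {E : B → B → Set} where

    from-edge : ∀ {x y} → E x y → (E on to) (from x) (from y)
    from-edge {x} {y} = subst₂ E (sym (strictlyInverseˡ x)) (sym (strictlyInverseˡ y))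

    private
      module To = Mapping {E = E on to} {E′ = E} to to-injective (λ e → e)
      module From = Mapping {E = E} {E′ = E on to} from from-injective from-edge

    IsPath-pullback : ∀ {P} → IsPathᴱ E P → IsPathᴱ (E on to) (map from P)
    IsPath-pullback = From.map-IsPath

    UniquelyConnected-pullback : UniquelyConnected E → UniquelyConnected (E on to)
    UniquelyConnected-pullback connected x y with connected (to x) (to y)
    ... | P , (path , start , end) , unique =
      map from P ,
      (IsPath-pullback path ,
       subst (StartsAt (map from P)) (strictlyInverseʳ x) (From.map-StartsAt start) ,
       subst (EndsAt (map from P)) (strictlyInverseʳ y) (From.map-EndsAt end)) ,
      λ Q Q-path Q-start Q-end → trans (sym (map-from-to Q)) (cong (map from)
        (unique (map to Q) (To.map-IsPath Q-path) (To.map-StartsAt Q-start) (To.map-EndsAt Q-end)))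

    InterferesOn-pullback : ∀ r q → InterferesOnᴱ (E on to) (map from r) (map from q) ⇔ InterferesOnᴱ E r q
    InterferesOn-pullback r q = mk⇔
      (subst₂ (InterferesOnᴱ E) (map-to-from r) (map-to-from q) ∘ To.map-InterferesOn)
      From.map-InterferesOn

connected : ∀ {V : Set} {E : V → V → Set} → UniquelyConnected E → ∀ x y → Star E x y
connected unique x y with unique x y
... | P , ((linked , _) , start , end) , _ = proj₁ (Walks.walk-along P linked start end)

module _ {n : ℕ} (T : Tree n) where

  edge-irrefl : ∀ {x} → Edge (adj T) x x → ⊥
  edge-irrefl {x} e with trans (sym e) (irrefl T x)
  ... | ()

  edge-IsPath : ∀ {x y} → Edge (adj T) x y → IsPath (adj T) (x ∷ y ∷ [])
  edge-IsPath e = e ∷ [-] , ((λ { refl → edge-irrefl e }) ∷ []) ∷ [] ∷ []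

  tree-acyclic : Acyclic (Edge (adj T))
  tree-acyclic {x} {y} P e path start end with uniquePath T x y
  ... | _ , _ , unique =
    trans (unique P path start end) (sym (unique (x ∷ y ∷ []) (edge-IsPath e) (_ , refl) (x ∷ [] , refl)))

module Subdivision {n : ℕ} (T : Tree n) where
  open Walks

  infix 4 _~_
  _~_ : Fin n → Fin n → Set
  _~_ = Edge (adj T)

  ~-sym : ∀ {x y} → x ~ y → y ~ x
  ~-sym {x} {y} e = trans (symmetric T y x) e

  -- inj₂ (u , v) is the midpoint of the edge u v when u < v and u ~ v; every other pair is a leaf
  -- hanging at u, which makes the vertex set Fin n ⊎ Fin n × Fin n, numbered by Fin (n + n * n).
  Vertex : Set
  Vertex = Fin n ⊎ Fin n × Fin n

  _touches_ : Fin n → Fin n × Fin n → Bool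
  x touches (u , v) with x ≟ u | x ≟ v | u <? v
  ... | yes _ | _     | _     = true
  ... | no _  | yes _ | yes _ = adj T u v
  ... | no _  | _     | _     = false

  adjˢ : Vertex → Vertex → Bool
  adjˢ (inj₁ x) (inj₂ p) = x touches p
  adjˢ (inj₂ p) (inj₁ x) = x touches p
  adjˢ (inj₁ _) (inj₁ _) = false
  adjˢ (inj₂ _) (inj₂ _) = false

  infix 4 _~ˢ_
  _~ˢ_ : Vertex → Vertex → Set
  _~ˢ_ = Edge adjˢ

  mid : Fin n → Fin n → Fin n × Fin n
  mid a b with <-cmp a b
  ... | tri> _ _ _ = b , a
  ... | _          = a , b

  mid-< : ∀ {a b} → a < b → mid a b ≡ (a , b)
  mid-< {a} {b} a<b with <-cmp a b
  ... | tri< _ _ _  = refl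
  ... | tri≈ _ _ _  = refl
  ... | tri> a≮b _ _ = ⊥-elim (a≮b a<b)

  mid-> : ∀ {a b} → a < b → mid b a ≡ (a , b)
  mid-> {a} {b} a<b with <-cmp b a
  ... | tri< b<a _ _ = ⊥-elim (<-asym a<b b<a)
  ... | tri≈ _ _ b≯a = ⊥-elim (b≯a a<b)
  ... | tri> _ _ _   = refl

  mid-cases : ∀ a b → mid a b ≡ (a , b) ⊎ mid a b ≡ (b , a)
  mid-cases a b with <-cmp a b
  ... | tri< _ _ _ = inj₁ refl
  ... | tri≈ _ _ _ = inj₁ refl
  ... | tri> _ _ _ = inj₂ refl

  mid-injective : ∀ {x y a b} → mid x y ≡ mid a b → (x ≡ a × y ≡ b) ⊎ (x ≡ b × y ≡ a)
  mid-injective {x} {y} {a} {b} eq with mid-cases x y | mid-cases a b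
  ... | inj₁ e₁ | inj₁ e₂ with trans (sym e₁) (trans eq e₂)
  ...   | refl = inj₁ (refl , refl)
  mid-injective eq | inj₁ e₁ | inj₂ e₂ with trans (sym e₁) (trans eq e₂)
  ...   | refl = inj₂ (refl , refl)
  mid-injective eq | inj₂ e₁ | inj₁ e₂ with trans (sym e₁) (trans eq e₂)
  ...   | refl = inj₂ (refl , refl)
  mid-injective eq | inj₂ e₁ | inj₂ e₂ with trans (sym e₁) (trans eq e₂)
  ...   | refl = inj₁ (refl , refl)

  touches-first : ∀ u v → u touches (u , v) ≡ true
  touches-first u v with u ≟ u
  ... | yes _  = refl
  ... | no u≢u = ⊥-elim (u≢u refl)

  touches-second : ∀ {u v} → u ~ v → u < v → v touches (u , v) ≡ true
  touches-second {u} {v} e u<v with v ≟ u | v ≟ v | u <? v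
  ... | yes _ | _      | _       = refl
  ... | no _  | yes _  | yes _   = e
  ... | no _  | no v≢v | _       = ⊥-elim (v≢v refl)
  ... | no _  | yes _  | no u≮v  = ⊥-elim (u≮v u<v)

  touches-inv : ∀ {x u v} → x touches (u , v) ≡ true → x ≡ u ⊎ (x ≡ v × u ~ v × u < v)
  touches-inv {x} {u} {v} t with x ≟ u | x ≟ v | u <? v
  ... | yes x≡u | _       | _       = inj₁ x≡u
  ... | no _    | yes x≡v | yes u<v = inj₂ (x≡v , t , u<v)

  mid-touches : ∀ {a b} → a ~ b → a touches mid a b ≡ true × b touches mid a b ≡ true
  mid-touches {a} {b} e with <-cmp a b
  ... | tri< a<b _ _  = touches-first a b , touches-second e a<b
  ... | tri≈ _ refl _ = ⊥-elim (edge-irrefl T e)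
  ... | tri> _ _ b<a  = touches-second (~-sym e) b<a , touches-first b a

  touches-both : ∀ {x y p} → x touches p ≡ true → y touches p ≡ true → x ≢ y → p ≡ mid x y × x ~ y
  touches-both {x} {y} {u , v} tx ty x≢y with touches-inv {x} tx | touches-inv {y} ty
  ... | inj₁ refl              | inj₁ refl              = ⊥-elim (x≢y refl)
  ... | inj₁ refl              | inj₂ (refl , e , u<v)  = sym (mid-< u<v) , e
  ... | inj₂ (refl , e , u<v)  | inj₁ refl              = sym (mid-> u<v) , ~-sym e
  ... | inj₂ (refl , _ , _)    | inj₂ (refl , _ , _)    = ⊥-elim (x≢y refl)

  adjˢ-sym : ∀ u v → adjˢ u v ≡ adjˢ v u
  adjˢ-sym (inj₁ _) (inj₁ _) = refl
  adjˢ-sym (inj₁ _) (inj₂ _) = refl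
  adjˢ-sym (inj₂ _) (inj₁ _) = refl
  adjˢ-sym (inj₂ _) (inj₂ _) = refl

  adjˢ-irrefl : ∀ u → adjˢ u u ≡ false
  adjˢ-irrefl (inj₁ _) = refl
  adjˢ-irrefl (inj₂ _) = refl

  ~ˢ-sym : ∀ {u v} → u ~ˢ v → v ~ˢ u
  ~ˢ-sym {u} {v} e = trans (adjˢ-sym v u) e

  _≟ˢ_ : DecidableEquality Vertex
  _≟ˢ_ = Sum.≡-dec _≟_ (Product.≡-dec _≟_ _≟_)

  subdivide : List (Fin n) → List Vertex
  subdivide [] = []
  subdivide (x ∷ []) = inj₁ x ∷ []
  subdivide (x ∷ y ∷ xs) = inj₁ x ∷ inj₂ (mid x y) ∷ subdivide (y ∷ xs)

  mapMaybe-subdivide : ∀ xs → mapMaybe isInj₁ (subdivide xs) ≡ xs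
  mapMaybe-subdivide [] = refl
  mapMaybe-subdivide (x ∷ []) = refl
  mapMaybe-subdivide (x ∷ y ∷ xs) = cong (x ∷_) (mapMaybe-subdivide (y ∷ xs))

  subdivide-injective : ∀ {xs ys} → subdivide xs ≡ subdivide ys → xs ≡ ys
  subdivide-injective {xs} {ys} eq =
    trans (sym (mapMaybe-subdivide xs)) (trans (cong (mapMaybe isInj₁) eq) (mapMaybe-subdivide ys))

  ∈-subdivide⁺ : ∀ {z xs} → z ∈ xs → inj₁ z ∈ subdivide xs
  ∈-subdivide⁺ {xs = _ ∷ []} (here refl) = here refl
  ∈-subdivide⁺ {xs = _ ∷ _ ∷ _} (here refl) = here refl
  ∈-subdivide⁺ {xs = _ ∷ _ ∷ _} (there z∈) = there (there (∈-subdivide⁺ z∈))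

  ∈-subdivide⁻ : ∀ {z xs} → inj₁ z ∈ subdivide xs → z ∈ xs
  ∈-subdivide⁻ {xs = _ ∷ []} (here refl) = here refl
  ∈-subdivide⁻ {xs = _ ∷ _ ∷ _} (here refl) = here refl
  ∈-subdivide⁻ {xs = _ ∷ _ ∷ _} (there (there z∈)) = there (∈-subdivide⁻ z∈)

  midpoint∈subdivide⁻ : ∀ {p xs} → inj₂ p ∈ subdivide xs → Σ (Fin n) λ a → Σ (Fin n) λ b → p ≡ mid a b × a ∈ xs × b ∈ xs
  midpoint∈subdivide⁻ {xs = _ ∷ []} (here ())
  midpoint∈subdivide⁻ {xs = x ∷ y ∷ _} (there (here refl)) = x , y , refl , here refl , there (here refl)
  midpoint∈subdivide⁻ {xs = _ ∷ _ ∷ _} (there (there p∈)) with midpoint∈subdivide⁻ p∈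
  ... | a , b , p≡ , a∈ , b∈ = a , b , p≡ , there a∈ , there b∈

  subdivide-Linked : ∀ {xs} → Linked _~_ xs → Linked _~ˢ_ (subdivide xs)
  subdivide-Linked [] = []
  subdivide-Linked [-] = [-]
  subdivide-Linked (e ∷ [-]) = proj₁ (mid-touches e) ∷ proj₂ (mid-touches e) ∷ [-]
  subdivide-Linked (e ∷ l@(_ ∷ _)) = proj₁ (mid-touches e) ∷ proj₂ (mid-touches e) ∷ subdivide-Linked l

  subdivide-Unique : ∀ {xs} → Unique xs → Unique (subdivide xs)
  subdivide-Unique {[]} u = []
  subdivide-Unique {_ ∷ []} u = [] ∷ []
  subdivide-Unique {x ∷ y ∷ xs} u = ∉-Unique-∷ x∉ (∉-Unique-∷ mid∉ (subdivide-Unique (Unique-tail u)))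
    where
      x∉ : inj₁ x ∉ inj₂ (mid x y) ∷ subdivide (y ∷ xs)
      x∉ (there x∈) = head-∉ u (∈-subdivide⁻ x∈)
      mid∉ : inj₂ (mid x y) ∉ subdivide (y ∷ xs)
      mid∉ m∈ with midpoint∈subdivide⁻ m∈
      ... | a , b , m≡ , a∈ , b∈ with mid-injective m≡
      ... | inj₁ (refl , _) = head-∉ u a∈
      ... | inj₂ (refl , _) = head-∉ u b∈

  subdivide-IsPath : ∀ {xs} → IsPath (adj T) xs → IsPathᴱ _~ˢ_ (subdivide xs)
  subdivide-IsPath (linked , unique) = subdivide-Linked linked , subdivide-Unique unique

  lift : ∀ {x y} → Star _~_ x y → Star _~ˢ_ (inj₁ x) (inj₁ y)
  lift ε = ε
  lift (_◅_ {i = x} {j = y} e w) =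
    _◅_ {j = inj₂ (mid x y)} (proj₁ (mid-touches e)) (proj₂ (mid-touches e) ◅ lift w)

  subdivide-◅ : ∀ {x y z} (e : x ~ y) (w : Star _~_ y z) →
                subdivide (vertices (e ◅ w)) ≡ inj₁ x ∷ inj₂ (mid x y) ∷ subdivide (vertices w)
  subdivide-◅ e ε = refl
  subdivide-◅ e (_ ◅ _) = refl

  data Subdivided (x : Fin n) (P : List Vertex) : Vertex → Set where
    at-original : ∀ {z} (w : Star _~_ x z) → Unique (vertices w) →
                  P ≡ subdivide (vertices w) → Subdivided x P (inj₁ z)
    at-midpoint : ∀ {z p} (w : Star _~_ x z) → Unique (vertices w) → z touches p ≡ true →
                  P ≡ subdivide (vertices w) ++ [ inj₂ p ] → Subdivided x P (inj₂ p)

  subdivided : ∀ {x v} (w : Star _~ˢ_ (inj₁ x) v) → Unique (vertices w) → Subdivided x (vertices w) v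
  subdivided ε _ = at-original ε ([] ∷ []) refl
  subdivided (_◅_ {j = inj₁ _} () _)
  subdivided (_◅_ {j = inj₂ _} t ε) _ = at-midpoint ε ([] ∷ []) t refl
  subdivided (_◅_ {j = inj₂ _} _ (_◅_ {j = inj₂ _} () _))
  subdivided {x} (_◅_ {j = inj₂ p} t (_◅_ {j = inj₁ y} t′ w)) u
    with touches-both {x} {y} {p} t t′ (λ { refl → head-∉ u (there (start∈vertices w)) })
       | subdivided w (Unique-tail (Unique-tail u))
  ... | refl , e | at-original wᵀ uᵀ eq =
    at-original (e ◅ wᵀ) (∉-Unique-∷ x∉ uᵀ)
      (trans (cong (λ vs → inj₁ x ∷ inj₂ (mid x y) ∷ vs) eq) (sym (subdivide-◅ e wᵀ)))
    where
      x∉ : x ∉ vertices wᵀ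
      x∉ x∈ = head-∉ u (there (subst (inj₁ x ∈_) (sym eq) (∈-subdivide⁺ x∈)))
  ... | refl , e | at-midpoint wᵀ uᵀ z-touches eq =
    at-midpoint (e ◅ wᵀ) (∉-Unique-∷ x∉ uᵀ) z-touches
      (trans (cong (λ vs → inj₁ x ∷ inj₂ (mid x y) ∷ vs) eq) (cong (_++ _) (sym (subdivide-◅ e wᵀ))))
    where
      x∉ : x ∉ vertices wᵀ
      x∉ x∈ = head-∉ u (there (subst (inj₁ x ∈_) (sym eq) (∈-++⁺ˡ (∈-subdivide⁺ x∈))))

  tree-edge-walk : ∀ {x y} (e : x ~ y) (w : Star _~_ x y) → Unique (vertices w) → vertices w ≡ x ∷ y ∷ []
  tree-edge-walk e w u = tree-acyclic T (vertices w) e (vertices-Linked w , u) (vertices-StartsAt w) (vertices-EndsAt w)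

  -- A path between the ends of an edge x ─ p that is longer than the edge would run x … z p with
  -- z ~ x and p = mid x z, i.e. pass through p twice.
  subdivision-acyclic : Acyclic _~ˢ_
  subdivision-acyclic {inj₁ _} {inj₁ _} _ ()
  subdivision-acyclic {inj₂ _} {inj₂ _} _ ()
  subdivision-acyclic {inj₁ x} {inj₂ p} P t (linked , unique) start end
    with walk-along P linked start end
  ... | ω , refl with subdivided ω unique
  ... | at-midpoint {z} wᵀ uᵀ tz eq with x ≟ z
  ...   | yes refl = trans eq (cong (λ vs → subdivide vs ++ [ inj₂ p ]) (loop-unique wᵀ uᵀ))
  ...   | no x≢z with touches-both {x} {z} {p} t tz x≢z
  ...     | refl , e = ⊥-elim (head-∉ (Unique-tail unique′) (there (here refl)))
    where
      unique′ : Unique (inj₁ x ∷ inj₂ p ∷ inj₁ z ∷ inj₂ p ∷ [])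
      unique′ = subst Unique (trans eq (cong (λ vs → subdivide vs ++ [ inj₂ p ]) (tree-edge-walk e wᵀ uᵀ))) unique
  subdivision-acyclic {inj₂ p} {inj₁ x} P t (linked , unique) start end
    with walk-along P linked start end
  ... | _◅_ {j = inj₁ z} t₀ ω , refl with subdivided ω (Unique-tail unique)
  ... | at-original wᵀ uᵀ eq with z ≟ x
  ...   | yes refl = cong (inj₂ p ∷_) (trans eq (cong subdivide (loop-unique wᵀ uᵀ)))
  ...   | no z≢x with touches-both {z} {x} {p} t₀ t z≢x
  ...     | refl , e = ⊥-elim (head-∉ unique′ (there (here refl)))
    where
      unique′ : Unique (inj₂ p ∷ inj₁ z ∷ inj₂ p ∷ inj₁ x ∷ [])
      unique′ = subst Unique (cong (inj₂ p ∷_) (trans eq (cong subdivide (tree-edge-walk e wᵀ uᵀ)))) unique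

  anchor : Vertex → Fin n
  anchor (inj₁ x) = x
  anchor (inj₂ (u , _)) = u

  to-anchor : ∀ v → Star _~ˢ_ v (inj₁ (anchor v))
  to-anchor (inj₁ _) = ε
  to-anchor (inj₂ (u , v)) = touches-first u v ◅ ε

  subdivision-connected : ∀ u v → Star _~ˢ_ u v
  subdivision-connected u v =
    to-anchor u ◅◅ lift (connected (uniquePath T) (anchor u) (anchor v)) ◅◅ reverse (λ {u} {v} → ~ˢ-sym {u} {v}) (to-anchor v)

  subdivision-uniquely-connected : UniquelyConnected _~ˢ_
  subdivision-uniquely-connected = uniquely-connected _≟ˢ_ (λ {u} {v} → ~ˢ-sym {u} {v}) subdivision-acyclic subdivision-connected

  mid-injectiveˡ : ∀ {a b c} → mid a c ≡ mid b c → a ≡ b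
  mid-injectiveˡ eq with mid-injective eq
  ... | inj₁ (a≡b , _) = a≡b
  ... | inj₂ (a≡c , c≡b) = trans a≡c c≡b

  mid-injectiveʳ : ∀ {a b c} → mid a b ≡ mid a c → b ≡ c
  mid-injectiveʳ eq with mid-injective eq
  ... | inj₁ (_ , b≡c) = b≡c
  ... | inj₂ (a≡c , b≡a) = trans b≡a a≡c

  subdivide-FirstArc⁻ : ∀ xs {a′ b′} → FirstArc (subdivide xs) a′ b′ →
    Σ (Fin n) λ a → Σ (Fin n) λ b → FirstArc xs a b × a′ ≡ inj₁ a × b′ ≡ inj₂ (mid a b)
  subdivide-FirstArc⁻ (a ∷ b ∷ rest) (_ , refl) = a , b , (rest , refl) , refl , refl

  subdivide-LastArc : ∀ {xs c d} → LastArc xs c d → LastArc (subdivide xs) (inj₂ (mid c d)) (inj₁ d)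
  subdivide-LastArc {c = c} {d} (init , refl) = last-arc init
    where
      last-arc : ∀ init → LastArc (subdivide (init ++ c ∷ d ∷ [])) (inj₂ (mid c d)) (inj₁ d)
      last-arc [] = inj₁ c ∷ [] , refl
      last-arc (x ∷ []) = inj₁ x ∷ inj₂ (mid x c) ∷ inj₁ c ∷ [] , refl
      last-arc (x ∷ y ∷ init) with last-arc (y ∷ init)
      ... | init′ , eq = inj₁ x ∷ inj₂ (mid x y) ∷ init′ , cong (λ vs → inj₁ x ∷ inj₂ (mid x y) ∷ vs) eq

  subdivide-LastArc⁻ : ∀ xs {c′ d′} → LastArc (subdivide xs) c′ d′ →
    Σ (Fin n) λ c → Σ (Fin n) λ d → LastArc xs c d × c′ ≡ inj₂ (mid c d) × d′ ≡ inj₁ d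
  subdivide-LastArc⁻ [] ([] , ())
  subdivide-LastArc⁻ [] (_ ∷ _ , ())
  subdivide-LastArc⁻ (_ ∷ []) ([] , ())
  subdivide-LastArc⁻ (_ ∷ []) (_ ∷ [] , ())
  subdivide-LastArc⁻ (_ ∷ []) (_ ∷ _ ∷ _ , ())
  subdivide-LastArc⁻ (_ ∷ _ ∷ []) ([] , ())
  subdivide-LastArc⁻ (c ∷ d ∷ []) (_ ∷ [] , refl) = c , d , ([] , refl) , refl , refl
  subdivide-LastArc⁻ (_ ∷ _ ∷ _ ∷ _) ([] , ())
  subdivide-LastArc⁻ (_ ∷ _ ∷ _ ∷ _) (_ ∷ [] , ())
  subdivide-LastArc⁻ (x ∷ y ∷ xs) (_ ∷ _ ∷ init , eq)
    with subdivide-LastArc⁻ (y ∷ xs) (init , ∷-injectiveʳ (∷-injectiveʳ eq))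
  ... | c , d , (init′ , eq′) , c′≡ , d′≡ = c , d , (x ∷ init′ , cong (x ∷_) eq′) , c′≡ , d′≡

  path-between-originals : ∀ {P x z} → IsPathᴱ _~ˢ_ P → StartsAt P (inj₁ x) → EndsAt P (inj₁ z) →
                           Σ (List (Fin n)) λ xs → IsPath (adj T) xs × P ≡ subdivide xs
  path-between-originals (linked , unique) start end with walk-along _ linked start end
  ... | ω , refl with subdivided ω unique
  ... | at-original w u eq = vertices w , (vertices-Linked w , u) , eq

  InterferesOn-subdivide : ∀ r q → InterferesOn T r q ⇔ InterferesOnᴱ _~ˢ_ (subdivide r) (subdivide q)
  InterferesOn-subdivide r q = mk⇔ forward backward
    where
      forward : InterferesOn T r q → InterferesOnᴱ _~ˢ_ (subdivide r) (subdivide q)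
      forward (P , path , (a , b , (_ , refl) , (_ , refl)) , (c , d , q-last , P-last)) =
        subdivide P , subdivide-IsPath path ,
        (inj₁ a , inj₂ (mid a b) , (_ , refl) , (_ , refl)) ,
        (inj₂ (mid c d) , inj₁ d , subdivide-LastArc q-last , subdivide-LastArc P-last)

      backward : InterferesOnᴱ _~ˢ_ (subdivide r) (subdivide q) → InterferesOn T r q
      backward (P , path , (_ , _ , r-first , P-first) , (_ , _ , q-last , P-last))
        with subdivide-FirstArc⁻ r r-first | subdivide-LastArc⁻ q q-last
      ... | a , b , r-first′ , refl , refl | c , d , q-last′ , refl , refl
        with path-between-originals path (FirstArc⇒StartsAt P-first) (LastArc⇒EndsAt P-last)
      ... | xs , xs-path , refl with subdivide-FirstArc⁻ xs P-first | subdivide-LastArc⁻ xs P-last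
      ... | _ , _ , xs-first , refl , b≡ | _ , _ , xs-last , c≡ , refl =
        xs , xs-path ,
        (a , b , r-first′ , subst (FirstArc xs a) (sym (mid-injectiveʳ (Sum.inj₂-injective b≡))) xs-first) ,
        (c , d , q-last′ , subst (λ c′ → LastArc xs c′ d) (sym (mid-injectiveˡ (Sum.inj₂-injective c≡))) xs-last)

module SubdivisionTree {n : ℕ} (T : Tree n) where
  open Subdivision T

  numbering : Fin (n + n * n) ↔ Vertex
  numbering = ↔-trans +↔⊎ (↔-refl ⊎-↔ *↔×)

  open Inverse numbering using (to; from)

  tree : Tree (n + n * n)
  tree = record
    { adj = λ i j → adjˢ (to i) (to j)
    ; irrefl = λ i → adjˢ-irrefl (to i)
    ; symmetric = λ i j → adjˢ-sym (to i) (to j)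
    ; nonempty = ≤-trans (nonempty T) (m≤m+n n (n * n))
    ; uniquePath = UniquelyConnected-pullback numbering subdivision-uniquely-connected
    }

  transfer : List (Fin n) → List (Fin (n + n * n))
  transfer r = map from (subdivide r)

  transfer-length : ∀ r → 2 ≤ length r → 3 ≤ length (transfer r)
  transfer-length (_ ∷ []) (s≤s ())
  transfer-length (_ ∷ _ ∷ []) _ = s≤s (s≤s (s≤s z≤n))
  transfer-length (_ ∷ _ ∷ _ ∷ _) _ = s≤s (s≤s (s≤s z≤n))

  transfer-Request : ∀ r → Request T r → Request tree (transfer r)
  transfer-Request r (path , 2≤length) =
    IsPath-pullback numbering (subdivide-IsPath path) ,
    ≤-trans (s≤s (s≤s z≤n)) (transfer-length r 2≤length)

  transfer-injective : ∀ {r r′} → transfer r ≡ transfer r′ → r ≡ r′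
  transfer-injective eq = subdivide-injective (map-injective (from-injective numbering) eq)

  transfer-Interfere : ∀ r q → Interfere T r q ⇔ Interfere tree (transfer r) (transfer q)
  transfer-Interfere r q = transfer-InterferesOn r q ⊎-⇔ transfer-InterferesOn q r
    where
      transfer-InterferesOn : ∀ r q → InterferesOn T r q ⇔ InterferesOn tree (transfer r) (transfer q)
      transfer-InterferesOn r q =
        ⇔.trans (InterferesOn-subdivide r q) (⇔.sym (InterferesOn-pullback numbering (subdivide r) (subdivide q)))

lemma14 : ∀ {n m : ℕ} (T : Tree n) (R : Fin m → List (Fin n)) →
          (∀ i → Request T (R i)) →
          (∀ i j → R i ≡ R j → i ≡ j) →
          Σ ℕ λ n' → Σ (Tree n') λ T' → Σ (Fin m → List (Fin n')) λ R' →
            (∀ i → Request T' (R' i)) ×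
            (∀ i → 3 ≤ length (R' i)) ×
            (∀ i j → R' i ≡ R' j → i ≡ j) ×
            (∀ i j → i ≢ j → (Interfere T (R i) (R j) ⇔ Interfere T' (R' i) (R' j)))
lemma14 {n} T R requests distinct =
  n + n * n , tree , (λ i → transfer (R i)) ,
  (λ i → transfer-Request (R i) (requests i)) ,
  (λ i → transfer-length (R i) (proj₂ (requests i))) ,
  (λ i j eq → distinct i j (transfer-injective eq)) ,
  (λ i j _ → transfer-Interfere (R i) (R j))   -- holds for all pairs
  where open SubdivisionTree T
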